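{- Let $p$ and $p'$ be programs of the split fireball calculus and let $\pi'\triangleright\Gamma\vdash p':M$ be a type derivation. If $p\to_{\beta_f} p'$ then there exists a type derivation $\pi\triangleright\Gamma\vdash p:M$ such that $|\pi'|=|\pi|-1$.
   Context: Terms: $t,u ::= x \mid \lambda x.t \mid tu$, up to $\alpha$-equivalence; $t\{x\leftarrow u\}$ is capture-avoiding substitution. Values: $v ::= x \mid \lambda x.t$. Fireballs $f$ and inert terms $i$ are defined by mutual induction: $f ::= v \mid i$ and $i ::= x f_1 \dots f_n$ with $n>0$. Right evaluation contexts: $C ::= \langle\cdot\rangle \mid t\,C \mid C\,f$. Split fireball calculus: environments $E ::= \epsilon \mid [x\leftarrow i]:E$; programs $p=(t,E)$. Reduction: $(C\langle(\lambda x.t)v\rangle,E)\to_{\beta_v}(C\langle t\{x\leftarrow v\}\rangle,E)$ and $(C\langle(\lambda x.t)i\rangle,E)\to_{\beta_i}(C\langle t\rangle,[x\leftarrow i]:E)$; $\to_{\beta_f}=\to_{\beta_v}\cup\to_{\beta_i}$. Append: $\epsilon@[x\leftarrow i]=[x\leftarrow i]$, $([y\leftarrow i']:E)@[x\leftarrow i]=[y\leftarrow i']:(E@[x\leftarrow i])$. Multi types: linear types $L ::= M\multimap N$; multi types $M,N ::= [L_1,\dots,L_n]$ (finite multisets, $n\ge 0$); $\mathbf 0$ empty multiset, $\uplus$ multiset sum. Type context $\Gamma$: total map from variables to multi types with finite $\mathrm{dom}(\Gamma)=\{x\mid \Gamma(x)\ne\mathbf 0\}$; $(\Gamma\uplus\Delta)(x)=\Gamma(x)\uplus\Delta(x)$;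 $x:M$ maps $x$ to $M$ and all else to $\mathbf 0$; $\Gamma,x:M$ extends $\Gamma$ ($x\notin\mathrm{dom}(\Gamma)$) by $x\mapsto M$. Typing rules: (ax) $x:M\vdash x:M$; (@) from $\Gamma\vdash t:[M\multimap N]$ and $\Delta\vdash u:M$ infer $\Gamma\uplus\Delta\vdash tu:N$; ($\lambda$) from $\Gamma_k,x:M_k\vdash t:N_k$ for $k=1,\dots,n$ ($n\ge0$) infer $\Gamma_1\uplus\dots\uplus\Gamma_n\vdash\lambda x.t:[M_1\multimap N_1,\dots,M_n\multimap N_n]$; (es$_\epsilon$) from $\Gamma\vdash t:M$ infer $\Gamma\vdash (t,\epsilon):M$; (es$_@$) from $\Gamma,x:M\vdash(t,E):N$ and $\Delta\vdash i:M$ infer $\Gamma\uplus\Delta\vdash(t,E@[x\leftarrow i]):N$. $|\pi|$ is the number of (@) rules in $\pi$. -}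

module Defs where

open import Data.Nat using (ℕ; zero; suc; _+_)
open import Data.Fin using (Fin; zero; suc)
open import Data.List using (List; []; _∷_; _++_)
open import Data.Vec using (Vec; []; _∷_; zipWith; replicate)
open import Data.Vec.Relation.Binary.Pointwise.Inductive using (Pointwise)

-- Terms, up to α-equivalence: intrinsically scoped de Bruijn terms.
-- Term n = terms whose free variables are among n variables.

data Term (n : ℕ) : Set where
  var : Fin n → Term n
  lam : Term (suc n) → Term n
  app : Term n → Term n → Term n

ext : ∀ {n m} → (Fin n → Fin m) → Fin (suc n) → Fin (suc m)
ext ρ zero    = zero
ext ρ (suc i) = suc (ρ i)

ren : ∀ {n m} → (Fin n → Fin m) → Term n → Term m
ren ρ (var x)   = var (ρ x)
ren ρ (lam t)   = lam (ren (ext ρ) t)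
ren ρ (app t u) = app (ren ρ t) (ren ρ u)

exts : ∀ {n m} → (Fin n → Term m) → Fin (suc n) → Term (suc m)
exts σ zero    = var zero
exts σ (suc i) = ren suc (σ i)

sub : ∀ {n m} → (Fin n → Term m) → Term n → Term m
sub σ (var x)   = σ x
sub σ (lam t)   = lam (sub (exts σ) t)
sub σ (app t u) = app (sub σ t) (sub σ u)

-- t [ u ] is t{x←u} where t is the body of λx.t (x = de Bruijn index 0)
single : ∀ {n} → Term n → Fin (suc n) → Term n
single u zero    = u
single u (suc i) = var i

_[_] : ∀ {n} → Term (suc n) → Term n → Term n
t [ u ] = sub (single u) t

data Value {n : ℕ} : Term n → Set where
  v-var : (x : Fin n) → Value (var x)
  v-lam : (t : Term (suc n)) → Value (lam t)

mutual
  data Fireball {n : ℕ} : Term n → Set where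
    f-val   : ∀ {t} → Value t → Fireball t
    f-inert : ∀ {t} → Inert t → Fireball t

  data Inert {n : ℕ} : Term n → Set where
    i-var : ∀ (x : Fin n) {f} → Fireball f → Inert (app (var x) f)
    i-app : ∀ {i f} → Inert i → Fireball f → Inert (app i f)

-- Right evaluation contexts  C ::= ⟨·⟩ | t C | C f

data ECtx (n : ℕ) : Set where
  hole : ECtx n
  _·C_ : Term n → ECtx n → ECtx n
  _C·_ : ECtx n → Term n → ECtx n

data IsEvalCtx {n : ℕ} : ECtx n → Set where
  e-hole : IsEvalCtx hole
  e-left : ∀ t {C} → IsEvalCtx C → IsEvalCtx (t ·C C)
  e-right : ∀ {C f} → IsEvalCtx C → Fireball f → IsEvalCtx (C C· f)

plug : ∀ {n} → ECtx n → Term n → Term n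
plug hole     s = s
plug (t ·C C) s = app t (plug C s)
plug (C C· u) s = app (plug C s) u

renC : ∀ {n m} → (Fin n → Fin m) → ECtx n → ECtx m
renC ρ hole     = hole
renC ρ (t ·C C) = ren ρ t ·C renC ρ C
renC ρ (C C· u) = renC ρ C C· ren ρ u

-- A program with free variables among n is either (t , ε), or
-- (t , E @ [x ← i]) where (t , E) is a program in scope n + x
-- (x = de Bruijn index 0) and i is an inert term in scope n.
-- The front entry of the environment is the innermost binding.

data Prog (n : ℕ) : Set where
  ⟨_,ε⟩ : Term n → Prog n
  _＠[_∣_] : Prog (suc n) → (i : Term n) → Inert i → Prog n

data _→βf_ {n : ℕ} : Prog n → Prog n → Set where
  βv : ∀ {C t v} → IsEvalCtx C → Value v →
       ⟨ plug C (app (lam t) v) ,ε⟩ →βf ⟨ plug C (t [ v ]) ,ε⟩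
  βi : ∀ {C t i} → IsEvalCtx C → (ii : Inert i) →
       ⟨ plug C (app (lam t) i) ,ε⟩ →βf (⟨ plug (renC suc C) t ,ε⟩ ＠[ i ∣ ii ])
  -- the term part is nested under the environment entries
  env : ∀ {p p' : Prog (suc n)} {i} {ii : Inert i} →
        p →βf p' → (p ＠[ i ∣ ii ]) →βf (p' ＠[ i ∣ ii ])

-- Multi types. Multisets are represented by lists, compared up to
-- (deep) permutation: ≈M / ≈L.

data Lin : Set where
  _⊸_ : List Lin → List Lin → Lin

Multi : Set
Multi = List Lin

𝟎 : Multi
𝟎 = []

mutual
  data _≈L_ : Lin → Lin → Set where
    ⊸-cong : ∀ {M M' N N'} → M ≈M M' → N ≈M N' → (M ⊸ N) ≈L (M' ⊸ N')

  data _≈M_ : Multi → Multi → Set where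
    ≈[]    : [] ≈M []
    ≈∷     : ∀ {a b as bs} → a ≈L b → as ≈M bs → (a ∷ as) ≈M (b ∷ bs)
    ≈swap  : ∀ {a b as} → (a ∷ b ∷ as) ≈M (b ∷ a ∷ as)
    ≈trans : ∀ {as bs cs} → as ≈M bs → bs ≈M cs → as ≈M cs

_⊎M_ : Multi → Multi → Multi
_⊎M_ = _++_

-- Type contexts over n variables (total maps, 𝟎 outside)
TCtx : ℕ → Set
TCtx n = Vec Multi n

_≈C_ : ∀ {n} → TCtx n → TCtx n → Set
_≈C_ = Pointwise _≈M_

_⊎C_ : ∀ {n} → TCtx n → TCtx n → TCtx n
_⊎C_ = zipWith _⊎M_

∅C : ∀ {n} → TCtx n
∅C = replicate _ 𝟎

_∶∶_ : ∀ {n} → Fin n → Multi → TCtx n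
_∶∶_ {suc n} zero    M = M ∷ ∅C
_∶∶_ {suc n} (suc x) M = 𝟎 ∷ (x ∶∶ M)

-- Type derivations. Since multisets are represented by lists, every
-- rule's conclusion is taken up to multiset equality (≈C, ≈M).
-- Γ , x : M  is  M ∷ Γ  (x = de Bruijn index 0).

mutual
  data _⊢_∶_ {n : ℕ} : TCtx n → Term n → Multi → Set where
    ax  : ∀ {Γ x M} → Γ ≈C (x ∶∶ M) → Γ ⊢ var x ∶ M
    ap  : ∀ {Γ Δ Θ t u T U M N} →
          Γ ⊢ t ∶ T → T ≈M ((M ⊸ N) ∷ []) →
          Δ ⊢ u ∶ U → U ≈M M →
          Θ ≈C (Γ ⊎C Δ) → Θ ⊢ app t u ∶ N
    lm  : ∀ {Γ Θ t P Q} → LamPrems t Γ P → Θ ≈C Γ → Q ≈M P →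
          Θ ⊢ lam t ∶ Q

  data LamPrems {n : ℕ} (t : Term (suc n)) : TCtx n → Multi → Set where
    []  : LamPrems t ∅C []
    _∷_ : ∀ {Γ Δ M N P} → (M ∷ Γ) ⊢ t ∶ N → LamPrems t Δ P →
          LamPrems t (Γ ⊎C Δ) ((M ⊸ N) ∷ P)

data _⊢P_∶_ {n : ℕ} : TCtx n → Prog n → Multi → Set where
  es-ε : ∀ {Γ t M} → Γ ⊢ t ∶ M → Γ ⊢P ⟨ t ,ε⟩ ∶ M
  es-app : ∀ {Γ Δ Θ p i M N} {ii : Inert i} →
         (M ∷ Γ) ⊢P p ∶ N → Δ ⊢ i ∶ M → Θ ≈C (Γ ⊎C Δ) →
         Θ ⊢P (p ＠[ i ∣ ii ]) ∶ N

mutual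
  size : ∀ {n} {Γ : TCtx n} {t M} → Γ ⊢ t ∶ M → ℕ
  size (ax _)               = 0
  size (ap π _ ρ _ _)       = suc (size π + size ρ)
  size (lm ps _ _)          = sizeL ps

  sizeL : ∀ {n} {t : Term (suc n)} {Γ P} → LamPrems t Γ P → ℕ
  sizeL []       = 0
  sizeL (π ∷ ps) = size π + sizeL ps

sizeP : ∀ {n} {Γ : TCtx n} {p M} → Γ ⊢P p ∶ M → ℕ
sizeP (es-ε π)     = size π
sizeP (es-app π ρ _) = sizeP π + size ρ

-- A derivation of C⟨t{x←v}⟩ splits into a typing of the context C with a hole of some
-- type K and a derivation of t{x←v} : K. The latter is split again, by induction on t,
-- into a derivation of t with x : M and a derivation of v : M: this works because v is a
-- value, so it is typable with 𝟎 at no cost and any two of its typings add up to one,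
-- whichever number of times x occurs in t. Rebuilding (λx.t) v from these pieces costs
-- exactly one more (@). For βi the inert term i is already typed by the environment
-- entry, and x does not occur in C, so the typing of C lives in the smaller context.

module Submission where

open import Defs
open import Algebra.Bundles using (CommutativeMonoid)
import Algebra.Properties.CommutativeSemigroup as CommSemigroupProperties
open import Data.Fin using (Fin; zero; suc; punchIn)
open import Data.List using ([]; _∷_)
open import Data.List.Properties using (++-assoc; ++-identityʳ)
open import Data.Nat using (ℕ; zero; suc; _+_)
open import Data.Nat.Properties using (+-assoc; +-suc; +-identityʳ; +-commutativeSemigroup)
open import Data.Product using (Σ; _,_; _×_)
open import Data.Vec using ([]; _∷_; insertAt)
import Data.Vec.Relation.Binary.Pointwise.Inductive as Pointwise
open import Data.Vec.Relation.Binary.Pointwise.Inductive using (_∷_)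
open import Function using (_∘_)
open import Relation.Binary.PropositionalEquality
  using (_≡_; _≗_; refl; sym; trans; cong; cong₂; module ≡-Reasoning)
open import Relation.Binary.Structures using (IsEquivalence)

mutual
  ≈L-refl : ∀ {a} → a ≈L a
  ≈L-refl {M ⊸ N} = ⊸-cong ≈M-refl ≈M-refl

  ≈M-refl : ∀ {M} → M ≈M M
  ≈M-refl {[]}    = ≈[]
  ≈M-refl {a ∷ M} = ≈∷ ≈L-refl ≈M-refl

mutual
  ≈L-sym : ∀ {a b} → a ≈L b → b ≈L a
  ≈L-sym (⊸-cong p q) = ⊸-cong (≈M-sym p) (≈M-sym q)

  ≈M-sym : ∀ {M N} → M ≈M N → N ≈M M
  ≈M-sym ≈[]          = ≈[]
  ≈M-sym (≈∷ p q)     = ≈∷ (≈L-sym p) (≈M-sym q)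
  ≈M-sym ≈swap        = ≈swap
  ≈M-sym (≈trans p q) = ≈trans (≈M-sym q) (≈M-sym p)

≡⇒≈M : ∀ {M N} → M ≡ N → M ≈M N
≡⇒≈M refl = ≈M-refl

⊎M-congˡ : ∀ {M M'} N → M ≈M M' → (M ⊎M N) ≈M (M' ⊎M N)
⊎M-congˡ N ≈[]          = ≈M-refl
⊎M-congˡ N (≈∷ p q)     = ≈∷ p (⊎M-congˡ N q)
⊎M-congˡ N ≈swap        = ≈swap
⊎M-congˡ N (≈trans p q) = ≈trans (⊎M-congˡ N p) (⊎M-congˡ N q)

⊎M-congʳ : ∀ M {N N'} → N ≈M N' → (M ⊎M N) ≈M (M ⊎M N')
⊎M-congʳ []      p = p
⊎M-congʳ (a ∷ M) p = ≈∷ ≈L-refl (⊎M-congʳ M p)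

⊎M-cong : ∀ {M M' N N'} → M ≈M M' → N ≈M N' → (M ⊎M N) ≈M (M' ⊎M N')
⊎M-cong {M' = M'} {N} p q = ≈trans (⊎M-congˡ N p) (⊎M-congʳ M' q)

∷-⊎M : ∀ a M N → (a ∷ (M ⊎M N)) ≈M (M ⊎M (a ∷ N))
∷-⊎M a []      N = ≈M-refl
∷-⊎M a (b ∷ M) N = ≈trans ≈swap (≈∷ ≈L-refl (∷-⊎M a M N))

⊎M-comm : ∀ M N → (M ⊎M N) ≈M (N ⊎M M)
⊎M-comm []      N = ≡⇒≈M (sym (++-identityʳ N))
⊎M-comm (a ∷ M) N = ≈trans (≈∷ ≈L-refl (⊎M-comm M N)) (∷-⊎M a N M)

≈M-isEquivalence : IsEquivalence _≈M_
≈M-isEquivalence = record { refl = ≈M-refl ; sym = ≈M-sym ; trans = ≈trans }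

⊎M-commutativeMonoid : CommutativeMonoid _ _
⊎M-commutativeMonoid = record
  { Carrier = Multi ; _≈_ = _≈M_ ; _∙_ = _⊎M_ ; ε = 𝟎
  ; isCommutativeMonoid = record
    { isMonoid = record
      { isSemigroup = record
        { isMagma = record { isEquivalence = ≈M-isEquivalence ; ∙-cong = ⊎M-cong }
        ; assoc = λ M N P → ≡⇒≈M (++-assoc M N P) }
      ; identity = (λ _ → ≈M-refl) , (λ M → ≡⇒≈M (++-identityʳ M)) }
    ; comm = ⊎M-comm } }

module ⊎M = CommutativeMonoid ⊎M-commutativeMonoid

⊎C-commutativeMonoid : ℕ → CommutativeMonoid _ _
⊎C-commutativeMonoid n = record
  { Carrier = TCtx n ; _≈_ = _≈C_ ; _∙_ = _⊎C_ ; ε = ∅C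
  ; isCommutativeMonoid = record
    { isMonoid = record
      { isSemigroup = record
        { isMagma = record
          { isEquivalence = Pointwise.isEquivalence ≈M-isEquivalence n
          ; ∙-cong = Pointwise.zipWith-cong ⊎M.∙-cong }
        ; assoc = Pointwise.zipWith-assoc ⊎M.assoc }
      ; identity = Pointwise.zipWith-identityˡ ⊎M.identityˡ
                 , Pointwise.zipWith-identityʳ ⊎M.identityʳ }
    ; comm = Pointwise.zipWith-comm ⊎M.comm } }

module ⊎C {n : ℕ} where
  open CommutativeMonoid (⊎C-commutativeMonoid n) public
  open CommSemigroupProperties commutativeSemigroup public

module + = CommSemigroupProperties +-commutativeSemigroup
open ≡-Reasoning

⊢-resp-≈C : ∀ {n} {Γ Γ' : TCtx n} {t M} → Γ ≈C Γ' → Γ ⊢ t ∶ M → Γ' ⊢ t ∶ M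
⊢-resp-≈C p (ax q)         = ax (⊎C.trans (⊎C.sym p) q)
⊢-resp-≈C p (ap π a ρ b q) = ap π a ρ b (⊎C.trans (⊎C.sym p) q)
⊢-resp-≈C p (lm ps q r)    = lm ps (⊎C.trans (⊎C.sym p) q) r

size-⊢-resp-≈C : ∀ {n} {Γ Γ' : TCtx n} {t M} (p : Γ ≈C Γ') (π : Γ ⊢ t ∶ M) →
                 size (⊢-resp-≈C p π) ≡ size π
size-⊢-resp-≈C p (ax q)         = refl
size-⊢-resp-≈C p (ap π a ρ b q) = refl
size-⊢-resp-≈C p (lm ps q r)    = refl

≡⇒≈C : ∀ {n} {Γ Δ : TCtx n} → Γ ≡ Δ → Γ ≈C Δ
≡⇒≈C refl = ⊎C.refl

insertAt-∅C : ∀ {n} (k : Fin (suc n)) → insertAt (∅C {n}) k 𝟎 ≡ ∅C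
insertAt-∅C zero              = refl
insertAt-∅C {suc n} (suc k) = cong (𝟎 ∷_) (insertAt-∅C k)

insertAt-∶∶ : ∀ {n} (k : Fin (suc n)) (x : Fin n) M →
              insertAt (x ∶∶ M) k 𝟎 ≡ (punchIn k x ∶∶ M)
insertAt-∶∶ {suc n} zero    x       M = refl
insertAt-∶∶ {suc n} (suc k) zero    M = cong (M ∷_) (insertAt-∅C k)
insertAt-∶∶ {suc n} (suc k) (suc x) M = cong (𝟎 ∷_) (insertAt-∶∶ k x M)

insertAt-⊎C : ∀ {n} (k : Fin (suc n)) (Γ Δ : TCtx n) →
              (insertAt Γ k 𝟎 ⊎C insertAt Δ k 𝟎) ≡ insertAt (Γ ⊎C Δ) k 𝟎
insertAt-⊎C zero    Γ       Δ       = refl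
insertAt-⊎C (suc k) (A ∷ Γ) (B ∷ Δ) = cong ((A ⊎M B) ∷_) (insertAt-⊎C k Γ Δ)

mutual
  ⊢-strengthen : ∀ {n} (k : Fin (suc n)) {ρ : Fin n → Fin (suc n)} → ρ ≗ punchIn k →
                 (t : Term n) {Γ : TCtx (suc n)} {M : Multi} (π : Γ ⊢ ren ρ t ∶ M) →
                 Σ (TCtx n) λ Γ' → Σ (Γ' ⊢ t ∶ M) λ π' →
                   Γ ≈C insertAt Γ' k 𝟎 × size π' ≡ size π
  ⊢-strengthen k ρ≗ (var x) {M = M} (ax q) =
    x ∶∶ M , ax ⊎C.refl ,
    ⊎C.trans q (≡⇒≈C (trans (cong (_∶∶ M) (ρ≗ x)) (sym (insertAt-∶∶ k x M)))) , refl
  ⊢-strengthen k ρ≗ (app t u) (ap π a ρ b q)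
    with ⊢-strengthen k ρ≗ t π | ⊢-strengthen k ρ≗ u ρ
  ... | Γ₁ , π₁ , e₁ , s₁ | Γ₂ , ρ₂ , e₂ , s₂ =
    Γ₁ ⊎C Γ₂ , ap π₁ a ρ₂ b ⊎C.refl ,
    ⊎C.trans q (⊎C.trans (⊎C.∙-cong e₁ e₂) (≡⇒≈C (insertAt-⊎C k Γ₁ Γ₂))) ,
    cong suc (cong₂ _+_ s₁ s₂)
  ⊢-strengthen k ρ≗ (lam t) (lm ps q r) with LamPrems-strengthen k ρ≗ t ps
  ... | Γ' , ps' , e , s = Γ' , lm ps' ⊎C.refl r , ⊎C.trans q e , s

  LamPrems-strengthen : ∀ {n} (k : Fin (suc n)) {ρ : Fin n → Fin (suc n)} → ρ ≗ punchIn k →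
                        (t : Term (suc n)) {Γ : TCtx (suc n)} {P : Multi}
                        (ps : LamPrems (ren (ext ρ) t) Γ P) →
                        Σ (TCtx n) λ Γ' → Σ (LamPrems t Γ' P) λ ps' →
                          Γ ≈C insertAt Γ' k 𝟎 × sizeL ps' ≡ sizeL ps
  LamPrems-strengthen k ρ≗ t [] = ∅C , [] , ≡⇒≈C (sym (insertAt-∅C k)) , refl
  LamPrems-strengthen k {ρ} ρ≗ t (π ∷ ps)
    with ⊢-strengthen (suc k) ext≗ t π | LamPrems-strengthen k ρ≗ t ps
    where
      ext≗ : ext ρ ≗ punchIn (suc k)
      ext≗ zero    = refl
      ext≗ (suc x) = cong suc (ρ≗ x)
  ... | A ∷ Γ₁ , π₁ , M≈A ∷ e₁ , s₁ | Γ₂ , ps₂ , e₂ , s₂ =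
    Γ₁ ⊎C Γ₂ , ⊢-resp-≈C (⊎M.sym M≈A ∷ ⊎C.refl) π₁ ∷ ps₂ ,
    ⊎C.trans (⊎C.∙-cong e₁ e₂) (≡⇒≈C (insertAt-⊎C k Γ₁ Γ₂)) ,
    cong₂ _+_ (trans (size-⊢-resp-≈C _ π₁) s₁) s₂

⊢-strengthen₀ : ∀ {n} (t : Term n) {Γ : TCtx (suc n)} {M : Multi} (π : Γ ⊢ ren suc t ∶ M) →
                Σ (TCtx n) λ Γ' → Σ (Γ' ⊢ t ∶ M) λ π' → Γ ≈C (𝟎 ∷ Γ') × size π' ≡ size π
⊢-strengthen₀ = ⊢-strengthen zero (λ _ → refl)

∶∶-𝟎 : ∀ {n} (x : Fin n) → (x ∶∶ 𝟎) ≡ ∅C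
∶∶-𝟎 {suc n} zero    = refl
∶∶-𝟎 {suc n} (suc x) = cong (𝟎 ∷_) (∶∶-𝟎 x)

∶∶-⊎C : ∀ {n} (x : Fin n) M N → ((x ∶∶ M) ⊎C (x ∶∶ N)) ≈C (x ∶∶ (M ⊎M N))
∶∶-⊎C {suc n} zero    M N = ⊎M.refl ∷ ⊎C.identityˡ ∅C
∶∶-⊎C {suc n} (suc x) M N = ⊎M.refl ∷ ∶∶-⊎C x M N

LamPrems-⊎ : ∀ {n} {t : Term (suc n)} {Γ₁ Γ₂ P₁ P₂}
             (ps₁ : LamPrems t Γ₁ P₁) (ps₂ : LamPrems t Γ₂ P₂) →
             Σ (TCtx n) λ Γ → Σ (LamPrems t Γ (P₁ ⊎M P₂)) λ ps →
               Γ ≈C (Γ₁ ⊎C Γ₂) × sizeL ps ≡ sizeL ps₁ + sizeL ps₂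
LamPrems-⊎ {Γ₂ = Γ₂} [] ps₂ = Γ₂ , ps₂ , ⊎C.sym (⊎C.identityˡ Γ₂) , refl
LamPrems-⊎ (_∷_ {Γ = Γ} {Δ} π ps₁) ps₂ with LamPrems-⊎ ps₁ ps₂
... | Γ' , ps , e , s =
  Γ ⊎C Γ' , π ∷ ps ,
  ⊎C.trans (⊎C.∙-cong ⊎C.refl e) (⊎C.sym (⊎C.assoc Γ Δ _)) ,
  trans (cong (size π +_) s) (sym (+-assoc (size π) (sizeL ps₁) (sizeL ps₂)))

Value-⊢-𝟎 : ∀ {n} {v : Term n} → Value v → Σ (∅C ⊢ v ∶ 𝟎) λ π → size π ≡ 0
Value-⊢-𝟎 (v-var x) = ax (≡⇒≈C (sym (∶∶-𝟎 x))) , refl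
Value-⊢-𝟎 (v-lam t) = lm [] ⊎C.refl ≈[] , refl

Value-⊢-⊎ : ∀ {n} {v : Term n} {Γ₁ Γ₂ M N} → Value v →
            (π₁ : Γ₁ ⊢ v ∶ M) (π₂ : Γ₂ ⊢ v ∶ N) →
            Σ ((Γ₁ ⊎C Γ₂) ⊢ v ∶ (M ⊎M N)) λ π → size π ≡ size π₁ + size π₂
Value-⊢-⊎ {M = M} {N} (v-var x) (ax q₁) (ax q₂) =
  ax (⊎C.trans (⊎C.∙-cong q₁ q₂) (∶∶-⊎C x M N)) , refl
Value-⊢-⊎ (v-lam t) (lm ps₁ q₁ r₁) (lm ps₂ q₂ r₂) with LamPrems-⊎ ps₁ ps₂
... | Γ , ps , e , s = lm ps (⊎C.trans (⊎C.∙-cong q₁ q₂) (⊎C.sym e)) (⊎M.∙-cong r₁ r₂) , s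

Values : ∀ {m n} → (Fin m → Term n) → Set
Values σ = ∀ x → Value (σ x)

data _⊢ˢ_∶_ {n : ℕ} : TCtx n → ∀ {m} → (Fin m → Term n) → TCtx m → Set where
  nil  : ∀ {Γ σ} → Γ ≈C ∅C → Γ ⊢ˢ σ ∶ []
  cons : ∀ {m Γ Γ₁ Γ₂ M Δ} {σ : Fin (suc m) → Term n} →
         Γ₁ ⊢ σ zero ∶ M → Γ₂ ⊢ˢ σ ∘ suc ∶ Δ → Γ ≈C (Γ₁ ⊎C Γ₂) → Γ ⊢ˢ σ ∶ (M ∷ Δ)

sizeˢ : ∀ {m n} {Γ : TCtx n} {σ : Fin m → Term n} {Δ} → Γ ⊢ˢ σ ∶ Δ → ℕ
sizeˢ (nil _)      = 0
sizeˢ (cons π s _) = size π + sizeˢ s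

⊢ˢ-resp-≈C : ∀ {m n} {Γ Γ' : TCtx n} {σ : Fin m → Term n} {Δ} → Γ ≈C Γ' →
             (s : Γ ⊢ˢ σ ∶ Δ) → Σ (Γ' ⊢ˢ σ ∶ Δ) λ s' → sizeˢ s' ≡ sizeˢ s
⊢ˢ-resp-≈C p (nil q)      = nil (⊎C.trans (⊎C.sym p) q) , refl
⊢ˢ-resp-≈C p (cons π s q) = cons π s (⊎C.trans (⊎C.sym p) q) , refl

Values-⊢ˢ-∅C : ∀ {m n} {σ : Fin m → Term n} → Values σ →
               Σ (∅C ⊢ˢ σ ∶ ∅C) λ s → sizeˢ s ≡ 0
Values-⊢ˢ-∅C {zero}  vs = nil ⊎C.refl , refl
Values-⊢ˢ-∅C {suc m} vs with Value-⊢-𝟎 (vs zero) | Values-⊢ˢ-∅C (vs ∘ suc)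
... | π , e | s , e' = cons π s (⊎C.sym (⊎C.identityˡ ∅C)) , cong₂ _+_ e e'

Values-⊢ˢ-⊎C : ∀ {m n} {σ : Fin m → Term n} {Γ₁ Γ₂ Δ₁ Δ₂} → Values σ →
               (s₁ : Γ₁ ⊢ˢ σ ∶ Δ₁) (s₂ : Γ₂ ⊢ˢ σ ∶ Δ₂) →
               Σ ((Γ₁ ⊎C Γ₂) ⊢ˢ σ ∶ (Δ₁ ⊎C Δ₂)) λ s → sizeˢ s ≡ sizeˢ s₁ + sizeˢ s₂
Values-⊢ˢ-⊎C vs (nil q₁) (nil q₂) = nil (⊎C.trans (⊎C.∙-cong q₁ q₂) (⊎C.identityˡ ∅C)) , refl
Values-⊢ˢ-⊎C vs (cons {Γ₁ = Γ₁} {Γ₂} π₁ s₁ q₁) (cons {Γ₁ = Θ₁} {Θ₂} π₂ s₂ q₂)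
  with Value-⊢-⊎ (vs zero) π₁ π₂ | Values-⊢ˢ-⊎C (vs ∘ suc) s₁ s₂
... | π , eπ | s , es =
  cons π s (⊎C.trans (⊎C.∙-cong q₁ q₂) (⊎C.interchange Γ₁ Γ₂ Θ₁ Θ₂)) ,
  trans (cong₂ _+_ eπ es) (+.interchange (size π₁) (size π₂) (sizeˢ s₁) (sizeˢ s₂))

Values-⊢ˢ-∶∶ : ∀ {m n} {σ : Fin m → Term n} {Γ N} → Values σ → (x : Fin m) →
               (π : Γ ⊢ σ x ∶ N) → Σ (Γ ⊢ˢ σ ∶ (x ∶∶ N)) λ s → sizeˢ s ≡ size π
Values-⊢ˢ-∶∶ {Γ = Γ} vs zero π with Values-⊢ˢ-∅C (vs ∘ suc)
... | s , e = cons π s (⊎C.sym (⊎C.identityʳ Γ)) ,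
              trans (cong (size π +_) e) (+-identityʳ (size π))
Values-⊢ˢ-∶∶ {Γ = Γ} vs (suc x) π with Value-⊢-𝟎 (vs zero) | Values-⊢ˢ-∶∶ (vs ∘ suc) x π
... | π₀ , e₀ | s , e = cons π₀ s (⊎C.sym (⊎C.identityˡ Γ)) , cong₂ _+_ e₀ e

⊢ˢ-strengthen₀ : ∀ {m n} {σ : Fin m → Term n} {Γ Δ} (s : Γ ⊢ˢ ren suc ∘ σ ∶ Δ) →
                 Σ (TCtx n) λ Γ' → Γ ≈C (𝟎 ∷ Γ') × Σ (Γ' ⊢ˢ σ ∶ Δ) λ s' → sizeˢ s' ≡ sizeˢ s
⊢ˢ-strengthen₀ {zero} (nil q) = ∅C , q , nil ⊎C.refl , refl
⊢ˢ-strengthen₀ {suc m} {σ = σ} (cons π s q)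
  with ⊢-strengthen₀ (σ zero) π | ⊢ˢ-strengthen₀ {σ = σ ∘ suc} s
... | Γ₁ , π' , h₁ ∷ e₁ , eπ | Γ₂ , h₂ ∷ e₂ , s' , es =
  Γ₁ ⊎C Γ₂ , ⊎C.trans q (⊎M.∙-cong h₁ h₂ ∷ ⊎C.∙-cong e₁ e₂) ,
  cons π' s' ⊎C.refl , cong₂ _+_ eπ es

⊢ˢ-exts⁻ : ∀ {m n} {σ : Fin m → Term n} {A Δ Γ} (s : Γ ⊢ˢ exts σ ∶ (A ∷ Δ)) →
           Σ (TCtx n) λ Γ' → Γ ≈C (A ∷ Γ') × Σ (Γ' ⊢ˢ σ ∶ Δ) λ s' → sizeˢ s' ≡ sizeˢ s
⊢ˢ-exts⁻ {σ = σ} {A} (cons (ax q₁) s q) with ⊢ˢ-strengthen₀ {σ = σ} s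
... | Γ' , h ∷ e , s' , es =
  Γ' , ⊎C.trans q (⊎C.trans (⊎C.∙-cong q₁ (h ∷ e)) (⊎M.identityʳ A ∷ ⊎C.identityˡ Γ')) , s' , es

⊢ˢ-var⁻ : ∀ {m} {Γ Δ : TCtx m} (s : Γ ⊢ˢ var ∶ Δ) → Γ ≈C Δ × sizeˢ s ≡ 0
⊢ˢ-var⁻ {zero} {Δ = []} (nil q) = q , refl
⊢ˢ-var⁻ {suc m} {Δ = A ∷ Δ} (cons (ax q₁) s q) with ⊢ˢ-strengthen₀ {σ = var} s
... | Γ' , h ∷ e , s' , es with ⊢ˢ-var⁻ s'
... | Γ'≈Δ , s'≡0 =
  ⊎C.trans q (⊎C.trans (⊎C.∙-cong q₁ (h ∷ e)) (⊎M.identityʳ A ∷ ⊎C.trans (⊎C.identityˡ Γ') Γ'≈Δ)) ,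
  trans (sym es) s'≡0

ren-Value : ∀ {n m} (ρ : Fin n → Fin m) {v : Term n} → Value v → Value (ren ρ v)
ren-Value ρ (v-var x) = v-var (ρ x)
ren-Value ρ (v-lam t) = v-lam (ren (ext ρ) t)

exts-Values : ∀ {m n} {σ : Fin m → Term n} → Values σ → Values (exts σ)
exts-Values vs zero    = v-var zero
exts-Values vs (suc x) = ren-Value suc (vs x)

mutual
  ⊢-sub⁻ : ∀ {m n} {σ : Fin m → Term n} → Values σ → (t : Term m) {Γ : TCtx n} {N : Multi}
           (π : Γ ⊢ sub σ t ∶ N) →
           Σ (TCtx m) λ Δ → Σ (Δ ⊢ t ∶ N) λ π' → Σ (Γ ⊢ˢ σ ∶ Δ) λ s →
             size π ≡ size π' + sizeˢ s
  ⊢-sub⁻ vs (var x) π with Values-⊢ˢ-∶∶ vs x π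
  ... | s , e = _ , ax ⊎C.refl , s , sym e
  ⊢-sub⁻ vs (app t u) (ap π₁ a π₂ b q) with ⊢-sub⁻ vs t π₁ | ⊢-sub⁻ vs u π₂
  ... | Δ₁ , π₁' , s₁ , e₁ | Δ₂ , π₂' , s₂ , e₂ with Values-⊢ˢ-⊎C vs s₁ s₂
  ... | s , es with ⊢ˢ-resp-≈C (⊎C.sym q) s
  ... | s' , es' =
    Δ₁ ⊎C Δ₂ , ap π₁' a π₂' b ⊎C.refl , s' ,
    cong suc (begin
      size π₁ + size π₂                                        ≡⟨ cong₂ _+_ e₁ e₂ ⟩
      (size π₁' + sizeˢ s₁) + (size π₂' + sizeˢ s₂)            ≡⟨ +.interchange (size π₁') _ _ _ ⟩
      (size π₁' + size π₂') + (sizeˢ s₁ + sizeˢ s₂)            ≡⟨ cong (size π₁' + size π₂' +_) (sym (trans es' es)) ⟩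
      (size π₁' + size π₂') + sizeˢ s'                         ∎)
  ⊢-sub⁻ vs (lam t) (lm ps q r) with LamPrems-sub⁻ vs t ps
  ... | Δ , ps' , s , e with ⊢ˢ-resp-≈C (⊎C.sym q) s
  ... | s' , es' = Δ , lm ps' ⊎C.refl r , s' , trans e (cong (sizeL ps' +_) (sym es'))

  LamPrems-sub⁻ : ∀ {m n} {σ : Fin m → Term n} → Values σ → (t : Term (suc m)) {Γ : TCtx n} {P : Multi}
                  (ps : LamPrems (sub (exts σ) t) Γ P) →
                  Σ (TCtx m) λ Δ → Σ (LamPrems t Δ P) λ ps' → Σ (Γ ⊢ˢ σ ∶ Δ) λ s →
                    sizeL ps ≡ sizeL ps' + sizeˢ s
  LamPrems-sub⁻ vs t [] with Values-⊢ˢ-∅C vs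
  ... | s , e = ∅C , [] , s , sym e
  LamPrems-sub⁻ {σ = σ} vs t (_∷_ {M = M} {N} π ps) with ⊢-sub⁻ (exts-Values vs) t π | LamPrems-sub⁻ vs t ps
  ... | A ∷ Δ₁ , π' , s₁ , e₁ | Δ₂ , ps' , s₂ , e₂ with ⊢ˢ-exts⁻ {σ = σ} s₁
  ... | Γ₁ , M≈A ∷ q₁ , s₁' , es₁' with ⊢ˢ-resp-≈C (⊎C.sym q₁) s₁'
  ... | s₁'' , es₁'' with Values-⊢ˢ-⊎C vs s₁'' s₂
  ... | s , es =
    Δ₁ ⊎C Δ₂ , πt ∷ ps' , s ,
    (begin
      size π + sizeL ps                                ≡⟨ cong₂ _+_ e₁ e₂ ⟩
      (size π' + sizeˢ s₁) + (sizeL ps' + sizeˢ s₂)    ≡⟨ +.interchange (size π') _ _ _ ⟩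
      (size π' + sizeL ps') + (sizeˢ s₁ + sizeˢ s₂)    ≡⟨ cong₂ (λ a b → a + sizeL ps' + b) (sym (size-⊢-resp-≈C _ π')) s₁+s₂≡s ⟩
      (size πt + sizeL ps') + sizeˢ s                  ∎)
    where
      πt : (M ∷ Δ₁) ⊢ t ∶ N
      πt = ⊢-resp-≈C (⊎M.sym M≈A ∷ ⊎C.refl) π'
      s₁+s₂≡s : sizeˢ s₁ + sizeˢ s₂ ≡ sizeˢ s
      s₁+s₂≡s = sym (trans es (cong (_+ sizeˢ s₂) (trans es₁'' es₁')))

data _⊢ᶜ_∶_⇒_ {n : ℕ} : TCtx n → ECtx n → Multi → Multi → Set where
  hole  : ∀ {K} → ∅C ⊢ᶜ hole ∶ K ⇒ K
  left  : ∀ {Γ Δ t C T U K M N} →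
          Γ ⊢ t ∶ T → T ≈M ((M ⊸ N) ∷ []) → Δ ⊢ᶜ C ∶ K ⇒ U → U ≈M M →
          (Γ ⊎C Δ) ⊢ᶜ t ·C C ∶ K ⇒ N
  right : ∀ {Γ Δ C u T U K M N} →
          Γ ⊢ᶜ C ∶ K ⇒ T → T ≈M ((M ⊸ N) ∷ []) → Δ ⊢ u ∶ U → U ≈M M →
          (Γ ⊎C Δ) ⊢ᶜ C C· u ∶ K ⇒ N

sizeᶜ : ∀ {n} {Γ : TCtx n} {C K N} → Γ ⊢ᶜ C ∶ K ⇒ N → ℕ
sizeᶜ hole            = 0
sizeᶜ (left π _ c _)  = suc (size π + sizeᶜ c)
sizeᶜ (right c _ π _) = suc (sizeᶜ c + size π)

⊢-plug : ∀ {n} {Γ Δ : TCtx n} {C s K N} (c : Γ ⊢ᶜ C ∶ K ⇒ N) (π : Δ ⊢ s ∶ K) →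
         Σ ((Γ ⊎C Δ) ⊢ plug C s ∶ N) λ π' → size π' ≡ sizeᶜ c + size π
⊢-plug {Δ = Δ} hole π = ⊢-resp-≈C (⊎C.sym (⊎C.identityˡ Δ)) π , size-⊢-resp-≈C _ π
⊢-plug {Δ = Δ} (left {Γ = Γ} {Θ} π₁ a c b) π with ⊢-plug c π
... | π₂ , e =
  ap π₁ a π₂ b (⊎C.assoc Γ Θ Δ) ,
  cong suc (trans (cong (size π₁ +_) e) (sym (+-assoc (size π₁) (sizeᶜ c) (size π))))
⊢-plug {Δ = Δ} (right {Γ = Θ} {Γ} c a π₂ b) π with ⊢-plug c π
... | π₁ , e =
  ap π₁ a π₂ b (⊎C.xy∙z≈xz∙y Θ Γ Δ) ,
  cong suc (trans (cong (_+ size π₂) e) (+.xy∙z≈xz∙y (sizeᶜ c) (size π) (size π₂)))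

⊢-plug⁻ : ∀ {n} (C : ECtx n) {s : Term n} {Γ N} (π : Γ ⊢ plug C s ∶ N) →
          Σ (TCtx n) λ Γᶜ → Σ (TCtx n) λ Δ → Σ Multi λ K →
          Σ (Γᶜ ⊢ᶜ C ∶ K ⇒ N) λ c → Σ (Δ ⊢ s ∶ K) λ π' →
            Γ ≈C (Γᶜ ⊎C Δ) × size π ≡ sizeᶜ c + size π'
⊢-plug⁻ hole {Γ = Γ} {N} π = ∅C , Γ , N , hole , π , ⊎C.sym (⊎C.identityˡ Γ) , refl
⊢-plug⁻ (t ·C C) (ap {Γ = Γ₁} π₁ a π₂ b q) with ⊢-plug⁻ C π₂
... | Γᶜ , Δ , K , c , π , e , s =
  Γ₁ ⊎C Γᶜ , Δ , K , left π₁ a c b , π ,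
  ⊎C.trans q (⊎C.trans (⊎C.∙-cong ⊎C.refl e) (⊎C.sym (⊎C.assoc Γ₁ Γᶜ Δ))) ,
  cong suc (trans (cong (size π₁ +_) s) (sym (+-assoc (size π₁) (sizeᶜ c) (size π))))
⊢-plug⁻ (C C· u) (ap {Δ = Γ₂} π₁ a π₂ b q) with ⊢-plug⁻ C π₁
... | Γᶜ , Δ , K , c , π , e , s =
  Γᶜ ⊎C Γ₂ , Δ , K , right c a π₂ b , π ,
  ⊎C.trans q (⊎C.trans (⊎C.∙-cong e ⊎C.refl) (⊎C.xy∙z≈xz∙y Γᶜ Δ Γ₂)) ,
  cong suc (trans (cong (_+ size π₂) s) (+.xy∙z≈xz∙y (sizeᶜ c) (size π) (size π₂)))

⊢ᶜ-strengthen₀ : ∀ {n} (C : ECtx n) {Γ K N} (c : Γ ⊢ᶜ renC suc C ∶ K ⇒ N) →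
                 Σ (TCtx n) λ Γ' → Γ ≈C (𝟎 ∷ Γ') × Σ (Γ' ⊢ᶜ C ∶ K ⇒ N) λ c' → sizeᶜ c' ≡ sizeᶜ c
⊢ᶜ-strengthen₀ hole hole = ∅C , ⊎C.refl , hole , refl
⊢ᶜ-strengthen₀ (t ·C C) (left π a c b) with ⊢-strengthen₀ t π | ⊢ᶜ-strengthen₀ C c
... | Γ₁ , π' , h₁ ∷ e₁ , eπ | Γ₂ , h₂ ∷ e₂ , c' , ec =
  Γ₁ ⊎C Γ₂ , ⊎M.∙-cong h₁ h₂ ∷ ⊎C.∙-cong e₁ e₂ , left π' a c' b , cong suc (cong₂ _+_ eπ ec)
⊢ᶜ-strengthen₀ (C C· u) (right c a π b) with ⊢ᶜ-strengthen₀ C c | ⊢-strengthen₀ u π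
... | Γ₁ , h₁ ∷ e₁ , c' , ec | Γ₂ , π' , h₂ ∷ e₂ , eπ =
  Γ₁ ⊎C Γ₂ , ⊎M.∙-cong h₁ h₂ ∷ ⊎C.∙-cong e₁ e₂ , right c' a π' b , cong suc (cong₂ _+_ ec eπ)

⊢-redex : ∀ {n} {Γ Δ : TCtx n} {t u M N U} (π : (M ∷ Γ) ⊢ t ∶ N) (ρ : Δ ⊢ u ∶ U) → U ≈M M →
          Σ ((Γ ⊎C Δ) ⊢ app (lam t) u ∶ N) λ π' → size π' ≡ suc (size π + size ρ)
⊢-redex {Γ = Γ} {Δ} π ρ U≈M =
  ap (lm (π ∷ []) ⊎C.refl ⊎M.refl) ⊎M.refl ρ U≈M (⊎C.∙-cong (⊎C.sym (⊎C.identityʳ Γ)) ⊎C.refl) ,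
  cong (λ k → suc (k + size ρ)) (+-identityʳ (size π))

single-Values : ∀ {n} {v : Term n} → Value v → Values (single v)
single-Values v zero    = v
single-Values v (suc x) = v-var x

⊢-[]⁻ : ∀ {n} {Γ : TCtx n} {t v N} → Value v → (π : Γ ⊢ t [ v ] ∶ N) →
        Σ (Γ ⊢ app (lam t) v ∶ N) λ π' → size π' ≡ suc (size π)
⊢-[]⁻ {Γ = Γ} {t = t} v π with ⊢-sub⁻ (single-Values v) t π
... | A ∷ Δ , πt , cons {Γ₁ = Γ₁} πv s q , e with ⊢ˢ-var⁻ s | ⊢-redex πt πv ⊎M.refl
... | Γ₂≈Δ , s≡0 | π' , e' =
  ⊢-resp-≈C Γ≈ π' ,
  (begin
    size (⊢-resp-≈C Γ≈ π')                ≡⟨ trans (size-⊢-resp-≈C Γ≈ π') e' ⟩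
    suc (size πt + size πv)               ≡⟨ cong (λ k → suc (size πt + k)) (sym (+-identityʳ (size πv))) ⟩
    suc (size πt + (size πv + 0))         ≡⟨ cong (λ k → suc (size πt + (size πv + k))) (sym s≡0) ⟩
    suc (size πt + (size πv + sizeˢ s))   ≡⟨ cong suc (sym e) ⟩
    suc (size π)                          ∎)
  where
    Γ≈ : (Δ ⊎C Γ₁) ≈C Γ
    Γ≈ = ⊎C.sym (⊎C.trans q (⊎C.trans (⊎C.∙-cong ⊎C.refl Γ₂≈Δ) (⊎C.comm Γ₁ Δ)))

⊢-plug-expand : ∀ {n} (C : ECtx n) {s s' : Term n} →
                (∀ {Δ K} (π : Δ ⊢ s ∶ K) → Σ (Δ ⊢ s' ∶ K) λ π' → size π' ≡ suc (size π)) →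
                ∀ {Γ N} (π : Γ ⊢ plug C s ∶ N) →
                Σ (Γ ⊢ plug C s' ∶ N) λ π' → size π' ≡ suc (size π)
⊢-plug-expand C expand π with ⊢-plug⁻ C π
... | Γᶜ , Δ , K , c , πs , Γ≈ , e with expand πs
... | πs' , es' with ⊢-plug c πs'
... | π' , e' =
  ⊢-resp-≈C (⊎C.sym Γ≈) π' ,
  (begin
    size (⊢-resp-≈C (⊎C.sym Γ≈) π')   ≡⟨ trans (size-⊢-resp-≈C _ π') e' ⟩
    sizeᶜ c + size πs'                 ≡⟨ cong (sizeᶜ c +_) es' ⟩
    sizeᶜ c + suc (size πs)            ≡⟨ +-suc (sizeᶜ c) (size πs) ⟩
    suc (sizeᶜ c + size πs)            ≡⟨ cong suc (sym e) ⟩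
    suc (size π)                       ∎)

⊢-βi-expand : ∀ {n} (C : ECtx n) {t : Term (suc n)} {i : Term n} {Γ Δ M N}
              (π : (M ∷ Γ) ⊢ plug (renC suc C) t ∶ N) (ρ : Δ ⊢ i ∶ M) →
              Σ ((Γ ⊎C Δ) ⊢ plug C (app (lam t) i) ∶ N) λ π' → size π' ≡ suc (size π + size ρ)
⊢-βi-expand C {Γ = Γ} {Δ} π ρ with ⊢-plug⁻ (renC suc C) π
... | Γᶜ , A ∷ Θ , K , c , πt , e , s with ⊢ᶜ-strengthen₀ C c
... | Γᶜ' , Γᶜ≈ , c' , ec with ⊎C.trans e (⊎C.∙-cong Γᶜ≈ ⊎C.refl)
... | M≈A ∷ Γ≈ with ⊢-redex πt ρ M≈A
... | πr , er with ⊢-plug c' πr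
... | π' , e' =
  ⊢-resp-≈C Γ⊎Δ≈ π' ,
  (begin
    size (⊢-resp-≈C Γ⊎Δ≈ π')                 ≡⟨ trans (size-⊢-resp-≈C _ π') e' ⟩
    sizeᶜ c' + size πr                       ≡⟨ cong₂ _+_ ec er ⟩
    sizeᶜ c + suc (size πt + size ρ)         ≡⟨ +-suc (sizeᶜ c) _ ⟩
    suc (sizeᶜ c + (size πt + size ρ))       ≡⟨ cong suc (sym (+-assoc (sizeᶜ c) (size πt) (size ρ))) ⟩
    suc ((sizeᶜ c + size πt) + size ρ)       ≡⟨ cong (λ k → suc (k + size ρ)) (sym s) ⟩
    suc (size π + size ρ)                    ∎)
  where
    Γ⊎Δ≈ : (Γᶜ' ⊎C (Θ ⊎C Δ)) ≈C (Γ ⊎C Δ)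
    Γ⊎Δ≈ = ⊎C.sym (⊎C.trans (⊎C.∙-cong Γ≈ ⊎C.refl) (⊎C.assoc Γᶜ' Θ Δ))

proposition9 : ∀ {n : ℕ} {p p' : Prog n} {Γ : TCtx n} {M : Multi}
    → (π' : Γ ⊢P p' ∶ M) → p →βf p'
    → Σ (Γ ⊢P p ∶ M) (λ π → sizeP π ≡ suc (sizeP π'))
proposition9 (es-ε π) (βv {C = C} _ v) with ⊢-plug-expand C (⊢-[]⁻ v) π
... | π₀ , e = es-ε π₀ , e
proposition9 (es-app (es-ε π) ρ Γ≈) (βi {C = C} _ _) with ⊢-βi-expand C π ρ
... | π₀ , e = es-ε (⊢-resp-≈C (⊎C.sym Γ≈) π₀) , trans (size-⊢-resp-≈C _ π₀) e
proposition9 (es-app π ρ Γ≈) (env step) with proposition9 π step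
... | π₀ , e = es-app π₀ ρ Γ≈ , cong (_+ size ρ) e
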